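{- There exists an absolute constant $c>0$ such that for every $n\ge 1$ and every function $f\colon \mathbb F_2^n\to\{+1,-1\}$ it holds that $$D^{\rightarrow,U}_{c/n}(f^+)\;\ge\; D^{lin,U}_{1/3}(f).$$
   Context: Boolean values are written as $\pm1$ (bit $0\mapsto +1$, bit $1\mapsto -1$). For $f\colon\mathbb F_2^n\to\{+1,-1\}$ its XOR-function is $f^+\colon\mathbb F_2^n\times\mathbb F_2^n\to\{+1,-1\}$, $f^+(x,y)=f(x+y)$ (addition over $\mathbb F_2$). $U$ denotes the uniform distribution. $D^{lin,U}_\delta(f)$ is the smallest integer $k\ge 0$ such that there exist fixed vectors $\alpha_1,\dots,\alpha_k\in\mathbb F_2^n$ and a function $g\colon\mathbb F_2^k\to\{+1,-1\}$ with $\Pr_{x\sim U(\mathbb F_2^n)}[g(\alpha_1\cdot x,\dots,\alpha_k\cdot x)=f(x)]\ge 1-\delta$, where $\alpha\cdot x=\sum_i\alpha_ix_i$ over $\mathbb F_2$. For $F\colon\mathbb F_2^n\times\mathbb F_2^n\to\{+1,-1\}$, $D^{\rightarrow,U}_\delta(F)$ (one-way distributional communication complexity under the uniform distribution) is the smallest integer $t\ge0$ such that there exist a message function $M\colon\mathbb F_2^n\to\{0,1\}^t$ (Alice's message) and an output function $h\colon\{0,1\}^t\times\mathbb F_2^n\to\{+1,-1\}$ (Bob's output) with $\Pr_{x,y}[h(M(x),y)=F(x,y)]\ge 1-\delta$, where $x,y$ are independent and uniform over $\mathbb F_2^n$. -}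

module Defs where

open import Data.Bool using (Bool; true; false; _xor_; _∧_; not)
open import Data.Nat using (ℕ; zero; suc; _^_; _+_; NonZero)
open import Data.Nat.Properties using (m^n≢0)
open import Data.Integer using (+_)
open import Data.Rational using (ℚ; _/_; _-_; _≤_; 1ℚ)
open import Data.Vec using (Vec; []; _∷_; map)
open import Data.List using (List; []; _∷_; _++_; length; filter) renaming (map to mapL)
open import Data.Nat.ListAction using (sum)
open import Data.Product using (Σ; _×_; _,_)
open import Data.Bool.Properties using (T?)

-- F₂ is represented by Bool (false = 0, true = 1); a ±1-valued Boolean
-- function is represented by its bit value (bit 0 ↦ +1, bit 1 ↦ −1),
-- so f : 𝔽₂ⁿ → {+1,−1} is a function Vec Bool n → Bool.
𝔽₂^ : ℕ → Set
𝔽₂^ n = Vec Bool n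

_⊕_ : ∀ {n} → 𝔽₂^ n → 𝔽₂^ n → 𝔽₂^ n
[] ⊕ [] = []
(a ∷ as) ⊕ (b ∷ bs) = (a xor b) ∷ (as ⊕ bs)

_·_ : ∀ {n} → 𝔽₂^ n → 𝔽₂^ n → Bool
[] · [] = false
(a ∷ as) · (b ∷ bs) = (a ∧ b) xor (as · bs)

_==_ : Bool → Bool → Bool
true == b = b
false == b = not b

xorFn : ∀ {n} → (𝔽₂^ n → Bool) → 𝔽₂^ n → 𝔽₂^ n → Bool
xorFn f x y = f (x ⊕ y)

allVecs : (n : ℕ) → List (𝔽₂^ n)
allVecs zero = [] ∷ []
allVecs (suc n) = mapL (false ∷_) (allVecs n) ++ mapL (true ∷_) (allVecs n)

count : ∀ {A : Set} → (A → Bool) → List A → ℕ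
count p xs = length (filter (λ x → T? (p x)) xs)

PrU : (n : ℕ) → (𝔽₂^ n → Bool) → ℚ
PrU n p = (+ count p (allVecs n)) / (2 ^ n) where instance _ = m^n≢0 2 n

PrU² : (n : ℕ) → (𝔽₂^ n → 𝔽₂^ n → Bool) → ℚ
PrU² n p = (+ sum (mapL (λ x → count (p x) (allVecs n)) (allVecs n))) / (2 ^ (n + n))
  where instance _ = m^n≢0 2 (n + n)

LinearApprox : (n : ℕ) → ℚ → (𝔽₂^ n → Bool) → ℕ → Set
LinearApprox n δ f k =
  Σ (Vec (𝔽₂^ n) k) λ α → Σ (𝔽₂^ k → Bool) λ g →
    1ℚ - δ ≤ PrU n (λ x → g (map (_· x) α) == f x)

OneWayProtocol : (n : ℕ) → ℚ → (𝔽₂^ n → 𝔽₂^ n → Bool) → ℕ → Set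
OneWayProtocol n δ F t =
  Σ (𝔽₂^ n → Vec Bool t) λ M → Σ (Vec Bool t → 𝔽₂^ n → Bool) λ h →
    1ℚ - δ ≤ PrU² n (λ x y → h (M x) y == F x y)

-- Take a t-bit one-way protocol for f⁺ with error at most 1/(24n), and call a row x good when
-- Bob errs on at most a 1/(6n) fraction of the y; by Markov's inequality at least three quarters
-- of the rows are good. If two good rows x, x′ receive the same message, the triangle inequality
-- shows that f and its translate by x ⊕ x′ disagree on at most a 1/(3n) fraction of the inputs:
-- x ⊕ x′ is a near period of f. Let α be a basis of the annihilator of the span of the near
-- periods, of dimension k. Good rows sharing a message have the same image under α, so there are
-- at most 2ᵗ·2ⁿ⁻ᵏ good rows, which forces k ≤ t. Every vector of ker α is a sum of at most n near
-- periods, so by subadditivity f drifts by at most 1/3 along ker α. Averaging over the shifts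
-- r ∈ ker α, some decoder a ↦ f (φ a ⊕ r), with φ a section of α, therefore agrees with f on at
-- least two thirds of the inputs.
module Submission where

open import Defs

open import Algebra.Bundles using (CommutativeRing)
open import Data.Bool using (Bool; true; false; not; _∧_; _xor_; T)
import Data.Bool as Bool
open import Data.Bool.Properties
  using ( xor-assoc; xor-comm; xor-same; xor-identityʳ; ∧-distribˡ-xor; ∧-identityʳ; ∧-zeroʳ
        ; xor-∧-commutativeRing )
open import Data.Empty using (⊥-elim)
open import Data.Integer as ℤ using (ℤ; +_)
import Data.Integer.Properties as ℤ
open import Data.Integer.Tactic.RingSolver using () renaming (solve-∀ to ℤ-solve-∀)
open import Data.List using (List; []; _∷_; _++_; filter) renaming (map to mapL)
open import Data.List.Membership.Propositional using (_∈_)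
open import Data.List.Membership.Propositional.Properties
  using (∈-map⁺; ∈-map⁻; ∈-++⁺ˡ; ∈-++⁺ʳ; ∈-filter⁺; ∈-filter⁻)
open import Data.List.Properties using (map-++; map-∘)
open import Data.List.Relation.Unary.All as All using (All; []; _∷_)
open import Data.List.Relation.Unary.Any as Any using (here; there; any?; satisfied)
open import Data.Nat
  using (ℕ; zero; suc; pred; _+_; _*_; _^_; _≤_; _<_; _≤?_; _<?_; z≤n; s≤s; NonZero)
open import Data.Nat.ListAction using (sum)
open import Data.Nat.ListAction.Properties using (sum-++)
open import Data.Nat.Properties
open import Data.Nat.Tactic.RingSolver using (solve-∀)
open import Data.Product using (Σ; ∃; _×_; _,_; proj₁; proj₂)
open import Data.Rational as ℚ using (ℚ; _/_; 0ℚ; 1ℚ; toℚᵘ)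
open import Data.Rational.Properties
  using ( positive⁻¹; toℚᵘ-mono-≤; toℚᵘ-cancel-≤; toℚᵘ-injective; toℚᵘ-homo-+; toℚᵘ-homo‿-
        ; toℚᵘ-homo-*; toℚᵘ-fromℚᵘ )
open import Data.Rational.Unnormalised as ℚᵘ using (mkℚᵘ; *≤*)
  renaming (_≃_ to _≃ᵘ_; _≤_ to _≤ᵘ_)
import Data.Rational.Unnormalised.Properties as ℚᵘ
open import Data.Sum using (_⊎_; inj₁; inj₂)
open import Data.Vec using (Vec; []; _∷_; replicate; head; tail; map)
open import Data.Vec.Properties as Vec using (≡-dec; ∷-injective; map-cong)
open import Function using (_∘_; _⇔_; mk⇔; Equivalence)
open import Relation.Binary.PropositionalEquality
open import Relation.Nullary using (Dec; yes; no; contradiction)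
open import Relation.Nullary.Decidable using (⌊_⌋; toWitness)

open import Algebra.Properties.CommutativeSemigroup *-commutativeSemigroup
  using (x∙yz≈y∙xz)
open import Algebra.Properties.CommutativeSemigroup +-commutativeSemigroup
  using () renaming (interchange to +-interchange)
open import Algebra.Properties.CommutativeSemigroup
  (CommutativeRing.+-commutativeSemigroup xor-∧-commutativeRing)
  using () renaming (interchange to xor-interchange)

0ᵛ : ∀ {n} → 𝔽₂^ n
0ᵛ = replicate _ false

⊕-assoc : ∀ {n} (x y z : 𝔽₂^ n) → (x ⊕ y) ⊕ z ≡ x ⊕ (y ⊕ z)
⊕-assoc [] [] [] = refl
⊕-assoc (a ∷ x) (b ∷ y) (c ∷ z) = cong₂ _∷_ (xor-assoc a b c) (⊕-assoc x y z)

⊕-comm : ∀ {n} (x y : 𝔽₂^ n) → x ⊕ y ≡ y ⊕ x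
⊕-comm [] [] = refl
⊕-comm (a ∷ x) (b ∷ y) = cong₂ _∷_ (xor-comm a b) (⊕-comm x y)

⊕-identityˡ : ∀ {n} (x : 𝔽₂^ n) → 0ᵛ ⊕ x ≡ x
⊕-identityˡ [] = refl
⊕-identityˡ (a ∷ x) = cong (a ∷_) (⊕-identityˡ x)

⊕-identityʳ : ∀ {n} (x : 𝔽₂^ n) → x ⊕ 0ᵛ ≡ x
⊕-identityʳ x = trans (⊕-comm x 0ᵛ) (⊕-identityˡ x)

⊕-self : ∀ {n} (x : 𝔽₂^ n) → x ⊕ x ≡ 0ᵛ
⊕-self [] = refl
⊕-self (a ∷ x) = cong₂ _∷_ (xor-same a) (⊕-self x)

⊕-interchange : ∀ {n} (w x y z : 𝔽₂^ n) → (w ⊕ x) ⊕ (y ⊕ z) ≡ (w ⊕ y) ⊕ (x ⊕ z)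
⊕-interchange [] [] [] [] = refl
⊕-interchange (a ∷ w) (b ∷ x) (c ∷ y) (d ∷ z) =
  cong₂ _∷_ (xor-interchange a b c d) (⊕-interchange w x y z)

⊕-cancelˡ : ∀ {n} (x y : 𝔽₂^ n) → x ⊕ (x ⊕ y) ≡ y
⊕-cancelˡ x y = begin
  x ⊕ (x ⊕ y)  ≡⟨ ⊕-assoc x x y ⟨
  (x ⊕ x) ⊕ y  ≡⟨ cong (_⊕ y) (⊕-self x) ⟩
  0ᵛ ⊕ y       ≡⟨ ⊕-identityˡ y ⟩
  y            ∎
  where open ≡-Reasoning

⊕-cancelʳ : ∀ {n} (x y : 𝔽₂^ n) → (x ⊕ y) ⊕ y ≡ x
⊕-cancelʳ x y = begin
  (x ⊕ y) ⊕ y  ≡⟨ ⊕-assoc x y y ⟩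
  x ⊕ (y ⊕ y)  ≡⟨ cong (x ⊕_) (⊕-self y) ⟩
  x ⊕ 0ᵛ       ≡⟨ ⊕-identityʳ x ⟩
  x            ∎
  where open ≡-Reasoning

⊕≡0ᵛ⇒≡ : ∀ {n} {x y : 𝔽₂^ n} → x ⊕ y ≡ 0ᵛ → x ≡ y
⊕≡0ᵛ⇒≡ {x = x} {y} x⊕y≡0ᵛ = begin
  x            ≡⟨ ⊕-cancelʳ x y ⟨
  (x ⊕ y) ⊕ y  ≡⟨ cong (_⊕ y) x⊕y≡0ᵛ ⟩
  0ᵛ ⊕ y       ≡⟨ ⊕-identityˡ y ⟩
  y            ∎
  where open ≡-Reasoning

infixr 7 _•_

_•_ : ∀ {n} → Bool → 𝔽₂^ n → 𝔽₂^ n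
true • x = x
false • x = 0ᵛ

•-distribʳ-xor : ∀ {n} b c (x : 𝔽₂^ n) → (b xor c) • x ≡ (b • x) ⊕ (c • x)
•-distribʳ-xor true true x = sym (⊕-self x)
•-distribʳ-xor true false x = sym (⊕-identityʳ x)
•-distribʳ-xor false c x = sym (⊕-identityˡ (c • x))

·-zeroʳ : ∀ {n} (a : 𝔽₂^ n) → a · 0ᵛ ≡ false
·-zeroʳ [] = refl
·-zeroʳ (b ∷ a) = trans (cong ((b ∧ false) xor_) (·-zeroʳ a)) (trans (xor-identityʳ _) (∧-zeroʳ b))

·-zeroˡ : ∀ {n} (x : 𝔽₂^ n) → 0ᵛ · x ≡ false
·-zeroˡ [] = refl
·-zeroˡ (_ ∷ x) = ·-zeroˡ x

·-distribˡ-⊕ : ∀ {n} (a x y : 𝔽₂^ n) → a · (x ⊕ y) ≡ (a · x) xor (a · y)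
·-distribˡ-⊕ [] [] [] = refl
·-distribˡ-⊕ (a ∷ as) (b ∷ x) (c ∷ y) = begin
  (a ∧ (b xor c)) xor (as · (x ⊕ y))
    ≡⟨ cong₂ _xor_ (∧-distribˡ-xor a b c) (·-distribˡ-⊕ as x y) ⟩
  ((a ∧ b) xor (a ∧ c)) xor ((as · x) xor (as · y))
    ≡⟨ xor-interchange (a ∧ b) (a ∧ c) (as · x) (as · y) ⟩
  ((a ∧ b) xor (as · x)) xor ((a ∧ c) xor (as · y))
    ∎
  where open ≡-Reasoning

·-• : ∀ {n} (a x : 𝔽₂^ n) b → a · (b • x) ≡ (a · x) ∧ b
·-• a x true = sym (∧-identityʳ (a · x))
·-• a x false = trans (·-zeroʳ a) (sym (∧-zeroʳ (a · x)))

⟦_⟧ : ∀ {n k} → Vec (𝔽₂^ n) k → 𝔽₂^ n → 𝔽₂^ k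
⟦ α ⟧ x = map (_· x) α

⟦⟧-⊕ : ∀ {n k} (α : Vec (𝔽₂^ n) k) x y → ⟦ α ⟧ (x ⊕ y) ≡ ⟦ α ⟧ x ⊕ ⟦ α ⟧ y
⟦⟧-⊕ [] x y = refl
⟦⟧-⊕ (a ∷ α) x y = cong₂ _∷_ (·-distribˡ-⊕ a x y) (⟦⟧-⊕ α x y)

⟦⟧-0ᵛ : ∀ {n k} (α : Vec (𝔽₂^ n) k) → ⟦ α ⟧ 0ᵛ ≡ 0ᵛ
⟦⟧-0ᵛ [] = refl
⟦⟧-0ᵛ (a ∷ α) = cong₂ _∷_ (·-zeroʳ a) (⟦⟧-0ᵛ α)

⟦map⟧ : ∀ {m n k} (ρ : 𝔽₂^ n → 𝔽₂^ m) (π : 𝔽₂^ m → 𝔽₂^ n) → (∀ a z → ρ a · z ≡ a · π z) →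
  (α : Vec (𝔽₂^ n) k) → ∀ z → ⟦ map ρ α ⟧ z ≡ ⟦ α ⟧ (π z)
⟦map⟧ ρ π transpose α z = trans (sym (Vec.map-∘ (_· z) ρ α)) (map-cong (λ a → transpose a z) α)

infix 4 _==ᵛ_

_==ᵛ_ : ∀ {n} → 𝔽₂^ n → 𝔽₂^ n → Bool
[] ==ᵛ [] = true
(a ∷ x) ==ᵛ (b ∷ y) = (a == b) ∧ (x ==ᵛ y)

==ᵛ⇒≡ : ∀ {n} {x y : 𝔽₂^ n} → T (x ==ᵛ y) → x ≡ y
==ᵛ⇒≡ {x = []} {[]} _ = refl
==ᵛ⇒≡ {x = true ∷ x} {true ∷ y} x==y = cong (true ∷_) (==ᵛ⇒≡ x==y)
==ᵛ⇒≡ {x = false ∷ x} {false ∷ y} x==y = cong (false ∷_) (==ᵛ⇒≡ x==y)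

==ᵛ-refl : ∀ {n} (x : 𝔽₂^ n) → T (x ==ᵛ x)
==ᵛ-refl [] = _
==ᵛ-refl (true ∷ x) = ==ᵛ-refl x
==ᵛ-refl (false ∷ x) = ==ᵛ-refl x

allVecs-complete : ∀ {n} (x : 𝔽₂^ n) → x ∈ allVecs n
allVecs-complete [] = here refl
allVecs-complete (false ∷ x) = ∈-++⁺ˡ (∈-map⁺ (false ∷_) (allVecs-complete x))
allVecs-complete {suc n} (true ∷ x) =
  ∈-++⁺ʳ (mapL (false ∷_) (allVecs n)) (∈-map⁺ (true ∷_) (allVecs-complete x))

open ≤-Reasoning

𝟙 : Bool → ℕ
𝟙 true = 1
𝟙 false = 0

𝟙-T : ∀ {a} → T a → 𝟙 a ≡ 1
𝟙-T {true} _ = refl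

𝟙+𝟙-not : ∀ b → 𝟙 b + 𝟙 (not b) ≡ 1
𝟙+𝟙-not true = refl
𝟙+𝟙-not false = refl

𝟙-==+𝟙-xor : ∀ a b → 𝟙 (a == b) + 𝟙 (a xor b) ≡ 1
𝟙-==+𝟙-xor true true = refl
𝟙-==+𝟙-xor true false = refl
𝟙-==+𝟙-xor false true = refl
𝟙-==+𝟙-xor false false = refl

𝟙-xor-triangle : ∀ a b c → 𝟙 (a xor c) ≤ 𝟙 (a xor b) + 𝟙 (b xor c)
𝟙-xor-triangle true true c = ≤-refl
𝟙-xor-triangle false false c = ≤-refl
𝟙-xor-triangle true false true = z≤n
𝟙-xor-triangle true false false = ≤-refl
𝟙-xor-triangle false true true = s≤s z≤n
𝟙-xor-triangle false true false = z≤n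

𝟙*𝟙-positive : ∀ {a b} → 0 < 𝟙 a * 𝟙 b → T a × T b
𝟙*𝟙-positive {true} {true} _ = _ , _

𝟙*𝟙≤𝟙 : ∀ {a b c} → (T a → T b → T c) → 𝟙 a * 𝟙 b ≤ 𝟙 c
𝟙*𝟙≤𝟙 {true} {true} {true} _ = ≤-refl
𝟙*𝟙≤𝟙 {true} {true} {false} a→b→c = ⊥-elim (a→b→c _ _)
𝟙*𝟙≤𝟙 {true} {false} _ = z≤n
𝟙*𝟙≤𝟙 {false} _ = z≤n

∑ : ∀ n → (𝔽₂^ n → ℕ) → ℕ
∑ zero F = F []
∑ (suc n) F = ∑ n (λ x → F (false ∷ x)) + ∑ n (λ x → F (true ∷ x))

∑-cong : ∀ {n} {F G : 𝔽₂^ n → ℕ} → (∀ x → F x ≡ G x) → ∑ n F ≡ ∑ n G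
∑-cong {zero} F≡G = F≡G []
∑-cong {suc n} F≡G = cong₂ _+_ (∑-cong (F≡G ∘ (false ∷_))) (∑-cong (F≡G ∘ (true ∷_)))

∑-mono : ∀ {n} {F G : 𝔽₂^ n → ℕ} → (∀ x → F x ≤ G x) → ∑ n F ≤ ∑ n G
∑-mono {zero} F≤G = F≤G []
∑-mono {suc n} F≤G = +-mono-≤ (∑-mono (F≤G ∘ (false ∷_))) (∑-mono (F≤G ∘ (true ∷_)))

∑-mono-< : ∀ {n} {F G : 𝔽₂^ n → ℕ} → (∀ x → F x ≤ G x) → ∀ y → F y < G y → ∑ n F < ∑ n G
∑-mono-< {zero} F≤G [] Fy<Gy = Fy<Gy
∑-mono-< {suc n} F≤G (false ∷ y) Fy<Gy =
  +-mono-<-≤ (∑-mono-< (F≤G ∘ (false ∷_)) y Fy<Gy) (∑-mono (F≤G ∘ (true ∷_)))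
∑-mono-< {suc n} F≤G (true ∷ y) Fy<Gy =
  +-mono-≤-< (∑-mono (F≤G ∘ (false ∷_))) (∑-mono-< (F≤G ∘ (true ∷_)) y Fy<Gy)

∑-+ : ∀ n (F G : 𝔽₂^ n → ℕ) → ∑ n (λ x → F x + G x) ≡ ∑ n F + ∑ n G
∑-+ zero F G = refl
∑-+ (suc n) F G = trans (cong₂ _+_ (∑-+ n _ _) (∑-+ n _ _))
  (+-interchange (∑ n (F ∘ (false ∷_))) (∑ n (G ∘ (false ∷_))) (∑ n (F ∘ (true ∷_))) _)

∑-*ˡ : ∀ n c (F : 𝔽₂^ n → ℕ) → ∑ n (λ x → c * F x) ≡ c * ∑ n F
∑-*ˡ zero c F = refl
∑-*ˡ (suc n) c F = trans (cong₂ _+_ (∑-*ˡ n c _) (∑-*ˡ n c _)) (sym (*-distribˡ-+ c _ _))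

∑-const : ∀ n c → ∑ n (λ _ → c) ≡ 2 ^ n * c
∑-const zero c = sym (+-identityʳ c)
∑-const (suc n) c = trans (cong₂ _+_ (∑-const n c) (∑-const n c)) (doubling (2 ^ n) c)
  where
  doubling : ∀ a c → a * c + a * c ≡ 2 * a * c
  doubling = solve-∀

∑-zero : ∀ n → ∑ n (λ _ → 0) ≡ 0
∑-zero n = trans (∑-const n 0) (*-zeroʳ (2 ^ n))

∑-comm : ∀ m n (F : 𝔽₂^ m → 𝔽₂^ n → ℕ) → ∑ m (λ x → ∑ n (F x)) ≡ ∑ n (λ y → ∑ m (λ x → F x y))
∑-comm zero n F = refl
∑-comm (suc m) n F = trans (cong₂ _+_ (∑-comm m n _) (∑-comm m n _)) (sym (∑-+ n _ _))

∑-translate : ∀ {n} (F : 𝔽₂^ n → ℕ) z → ∑ n (λ x → F (x ⊕ z)) ≡ ∑ n F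
∑-translate F [] = refl
∑-translate F (false ∷ z) =
  cong₂ _+_ (∑-translate (F ∘ (false ∷_)) z) (∑-translate (F ∘ (true ∷_)) z)
∑-translate F (true ∷ z) =
  trans (cong₂ _+_ (∑-translate (F ∘ (true ∷_)) z) (∑-translate (F ∘ (false ∷_)) z))
        (+-comm (∑ _ (F ∘ (true ∷_))) _)

∑-<-witness : ∀ {n} (F G : 𝔽₂^ n → ℕ) → ∑ n F < ∑ n G → ∃ λ x → F x < G x
∑-<-witness {zero} F G F<G = [] , F<G
∑-<-witness {suc n} F G F<G with ∑ n (F ∘ (false ∷_)) <? ∑ n (G ∘ (false ∷_))
... | yes F₀<G₀ = let x , Fx<Gx = ∑-<-witness _ _ F₀<G₀ in false ∷ x , Fx<Gx
... | no F₀≮G₀ = let x , Fx<Gx = ∑-<-witness _ _ F₁<G₁ in true ∷ x , Fx<Gx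
  where
  F₁<G₁ : ∑ n (F ∘ (true ∷_)) < ∑ n (G ∘ (true ∷_))
  F₁<G₁ = +-cancelˡ-< (∑ n (G ∘ (false ∷_))) _ _ (≤-<-trans (+-monoˡ-≤ _ (≮⇒≥ F₀≮G₀)) F<G)

∑-positive : ∀ {n} (F : 𝔽₂^ n → ℕ) → 0 < ∑ n F → ∃ λ x → 0 < F x
∑-positive {n} F 0<∑ = ∑-<-witness (λ _ → 0) F (subst (_< ∑ n F) (sym (∑-zero n)) 0<∑)

∑-delta : ∀ {n} (x : 𝔽₂^ n) (G : 𝔽₂^ n → ℕ) → ∑ n (λ y → 𝟙 (x ==ᵛ y) * G y) ≡ G x
∑-delta [] G = +-identityʳ (G [])
∑-delta {suc n} (false ∷ x) G =
  trans (cong₂ _+_ (∑-delta x (G ∘ (false ∷_))) (∑-zero n)) (+-identityʳ (G (false ∷ x)))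
∑-delta {suc n} (true ∷ x) G = cong₂ _+_ (∑-zero n) (∑-delta x (G ∘ (true ∷_)))

∑-allVecs : ∀ n (F : 𝔽₂^ n → ℕ) → sum (mapL F (allVecs n)) ≡ ∑ n F
∑-allVecs zero F = +-identityʳ (F [])
∑-allVecs (suc n) F = begin-equality
  sum (mapL F (mapL (false ∷_) xs ++ mapL (true ∷_) xs))
    ≡⟨ cong sum (map-++ F (mapL (false ∷_) xs) _) ⟩
  sum (mapL F (mapL (false ∷_) xs) ++ mapL F (mapL (true ∷_) xs))
    ≡⟨ sum-++ (mapL F (mapL (false ∷_) xs)) _ ⟩
  sum (mapL F (mapL (false ∷_) xs)) + sum (mapL F (mapL (true ∷_) xs))
    ≡⟨ cong₂ (λ u v → sum u + sum v) (map-∘ xs) (map-∘ xs) ⟨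
  sum (mapL (F ∘ (false ∷_)) xs) + sum (mapL (F ∘ (true ∷_)) xs)
    ≡⟨ cong₂ _+_ (∑-allVecs n _) (∑-allVecs n _) ⟩
  ∑ (suc n) F
    ∎
  where xs = allVecs n

count≡sum : ∀ {A : Set} (p : A → Bool) xs → count p xs ≡ sum (mapL (𝟙 ∘ p) xs)
count≡sum p [] = refl
count≡sum p (x ∷ xs) with p x
... | true = cong suc (count≡sum p xs)
... | false = count≡sum p xs

count-allVecs : ∀ n (p : 𝔽₂^ n → Bool) → count p (allVecs n) ≡ ∑ n (𝟙 ∘ p)
count-allVecs n p = trans (count≡sum p (allVecs n)) (∑-allVecs n (𝟙 ∘ p))

-- Hamming distance and drift

dist : ∀ {n} → (𝔽₂^ n → Bool) → (𝔽₂^ n → Bool) → ℕ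
dist {n} F G = ∑ n λ x → 𝟙 (F x xor G x)

dist-comm : ∀ {n} (F G : 𝔽₂^ n → Bool) → dist F G ≡ dist G F
dist-comm F G = ∑-cong λ x → cong 𝟙 (xor-comm (F x) (G x))

dist-triangle : ∀ {n} (F G H : 𝔽₂^ n → Bool) → dist F H ≤ dist F G + dist G H
dist-triangle {n} F G H =
  ≤-trans (∑-mono λ x → 𝟙-xor-triangle (F x) (G x) (H x)) (≤-reflexive (∑-+ n _ _))

dist-translate : ∀ {n} (F G : 𝔽₂^ n → Bool) z →
  dist (λ x → F (x ⊕ z)) (λ x → G (x ⊕ z)) ≡ dist F G
dist-translate F G = ∑-translate (λ x → 𝟙 (F x xor G x))

agreements+dist : ∀ {n} (F G : 𝔽₂^ n → Bool) →
  count (λ x → F x == G x) (allVecs n) + dist F G ≡ 2 ^ n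
agreements+dist {n} F G = begin-equality
  count (λ x → F x == G x) (allVecs n) + dist F G  ≡⟨ cong (_+ dist F G) (count-allVecs n _) ⟩
  ∑ n (λ x → 𝟙 (F x == G x)) + dist F G           ≡⟨ ∑-+ n _ _ ⟨
  ∑ n (λ x → 𝟙 (F x == G x) + 𝟙 (F x xor G x))    ≡⟨ ∑-cong (λ x → 𝟙-==+𝟙-xor (F x) (G x)) ⟩
  ∑ n (λ _ → 1)                                   ≡⟨ ∑-const n 1 ⟩
  2 ^ n * 1                                       ≡⟨ *-identityʳ (2 ^ n) ⟩
  2 ^ n                                           ∎

drift : ∀ {n} → (𝔽₂^ n → Bool) → 𝔽₂^ n → ℕ
drift f z = dist (λ x → f (x ⊕ z)) f

drift-0ᵛ : ∀ {n} (f : 𝔽₂^ n → Bool) → drift f 0ᵛ ≡ 0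
drift-0ᵛ {n} f = trans (∑-cong λ x → cong 𝟙 (vanishes x)) (∑-zero n)
  where
  vanishes : ∀ x → f (x ⊕ 0ᵛ) xor f x ≡ false
  vanishes x = trans (cong (λ y → f y xor f x) (⊕-identityʳ x)) (xor-same (f x))

drift-subadditive : ∀ {n} (f : 𝔽₂^ n → Bool) z w → drift f (z ⊕ w) ≤ drift f z + drift f w
drift-subadditive f z w = begin
  drift f (z ⊕ w)
    ≤⟨ dist-triangle (λ x → f (x ⊕ (z ⊕ w))) (λ x → f (x ⊕ z)) f ⟩
  dist (λ x → f (x ⊕ (z ⊕ w))) (λ x → f (x ⊕ z)) + drift f z
    ≡⟨ cong (_+ drift f z) (dist-translate (λ x → f (x ⊕ (z ⊕ w))) (λ x → f (x ⊕ z)) z) ⟨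
  dist (λ x → f ((x ⊕ z) ⊕ (z ⊕ w))) (λ x → f ((x ⊕ z) ⊕ z)) + drift f z
    ≡⟨ cong (_+ drift f z) (∑-cong λ x →
         cong₂ (λ u v → 𝟙 (f u xor f v)) (shift x) (⊕-cancelʳ x z)) ⟩
  drift f w + drift f z
    ≡⟨ +-comm (drift f w) (drift f z) ⟩
  drift f z + drift f w
    ∎
  where
  shift : ∀ x → (x ⊕ z) ⊕ (z ⊕ w) ≡ x ⊕ w
  shift x = trans (⊕-assoc x z (z ⊕ w)) (cong (x ⊕_) (⊕-cancelˡ z w))

-- Decoding along the kernel of a linear map

section : ∀ {n k} (A : 𝔽₂^ n → 𝔽₂^ k) → Σ (𝔽₂^ k → 𝔽₂^ n) λ φ → ∀ x → A (φ (A x)) ≡ A x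
section {n} A = φ , φ-section
  where
  preimage? : ∀ a → Dec (Any.Any (λ x → A x ≡ a) (allVecs n))
  preimage? a = any? (λ x → ≡-dec Bool._≟_ (A x) a) (allVecs n)

  φ : _ → 𝔽₂^ n
  φ a with preimage? a
  ... | yes found = proj₁ (satisfied found)
  ... | no _ = 0ᵛ

  φ-section : ∀ x → A (φ (A x)) ≡ A x
  φ-section x with preimage? (A x)
  ... | yes found = proj₂ (satisfied found)
  ... | no none = contradiction (Any.map (λ x≡y → cong A (sym x≡y)) (allVecs-complete x)) none

module _ {n k} (f : 𝔽₂^ n → Bool) (α : Vec (𝔽₂^ n) k) where

  private
    φ = proj₁ (section ⟦ α ⟧)
    φ-section = proj₂ (section ⟦ α ⟧)

  inKernel : 𝔽₂^ n → ℕ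
  inKernel w = 𝟙 (⟦ α ⟧ w ==ᵛ 0ᵛ)

  decoder : 𝔽₂^ n → 𝔽₂^ k → Bool
  decoder r a = f (φ a ⊕ r)

  decoder-error-average : ∑ n (λ r → inKernel r * dist (decoder r ∘ ⟦ α ⟧) f)
                        ≡ ∑ n (λ w → inKernel w * drift f w)
  decoder-error-average = begin-equality
    ∑ n (λ r → inKernel r * dist (decoder r ∘ ⟦ α ⟧) f)
      ≡⟨ ∑-cong (λ r → ∑-*ˡ n (inKernel r) _) ⟨
    ∑ n (λ r → ∑ n (λ u → inKernel r * 𝟙 (decoder r (⟦ α ⟧ u) xor f u)))
      ≡⟨ ∑-comm n n _ ⟩
    ∑ n (λ u → ∑ n (λ r → inKernel r * 𝟙 (decoder r (⟦ α ⟧ u) xor f u)))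
      ≡⟨ ∑-cong recentre ⟩
    ∑ n (λ u → ∑ n (λ w → inKernel w * 𝟙 (f (u ⊕ w) xor f u)))
      ≡⟨ ∑-comm n n _ ⟩
    ∑ n (λ w → ∑ n (λ u → inKernel w * 𝟙 (f (u ⊕ w) xor f u)))
      ≡⟨ ∑-cong (λ w → ∑-*ˡ n (inKernel w) _) ⟩
    ∑ n (λ w → inKernel w * drift f w)
      ∎
    where
    recentre : ∀ u → ∑ n (λ r → inKernel r * 𝟙 (decoder r (⟦ α ⟧ u) xor f u))
                   ≡ ∑ n (λ w → inKernel w * 𝟙 (f (u ⊕ w) xor f u))
    recentre u = trans (sym (∑-translate _ d)) (∑-cong λ w →
        cong₂ (λ v y → 𝟙 (v ==ᵛ 0ᵛ) * 𝟙 (f y xor f u)) (kernel-shift w) (decoded w))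
      where
      φu = φ (⟦ α ⟧ u)
      d = φu ⊕ u

      d∈kernel : ⟦ α ⟧ d ≡ 0ᵛ
      d∈kernel = trans (⟦⟧-⊕ α φu u) (trans (cong (_⊕ ⟦ α ⟧ u) (φ-section u)) (⊕-self _))

      kernel-shift : ∀ w → ⟦ α ⟧ (w ⊕ d) ≡ ⟦ α ⟧ w
      kernel-shift w = trans (⟦⟧-⊕ α w d) (trans (cong (⟦ α ⟧ w ⊕_) d∈kernel) (⊕-identityʳ _))

      decoded : ∀ w → φu ⊕ (w ⊕ d) ≡ u ⊕ w
      decoded w = trans (cong (φu ⊕_) (trans (⊕-comm w d) (⊕-assoc φu u w))) (⊕-cancelˡ φu (u ⊕ w))

  kernel-decoding : ∀ c b → (∀ w → ⟦ α ⟧ w ≡ 0ᵛ → c * drift f w ≤ b) →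
    Σ (𝔽₂^ k → Bool) λ g → c * dist (g ∘ ⟦ α ⟧) f ≤ b
  kernel-decoding c b bounded = decoder r , ≤-pred (*-cancelˡ-< (inKernel r) _ _ r-good)
    where
    error : 𝔽₂^ n → ℕ
    error r = dist (decoder r ∘ ⟦ α ⟧) f

    scaled : ∀ F → ∑ n (λ r → inKernel r * (c * F r)) ≡ c * ∑ n (λ r → inKernel r * F r)
    scaled F = trans (∑-cong λ r → x∙yz≈y∙xz (inKernel r) c (F r)) (∑-*ˡ n c _)

    weighted-bound : ∀ w → inKernel w * (c * drift f w) ≤ inKernel w * suc b
    weighted-bound w with ⟦ α ⟧ w ==ᵛ 0ᵛ in w∈kernel
    ... | true = *-monoʳ-≤ 1 (m≤n⇒m≤1+n (bounded w (==ᵛ⇒≡ (subst T (sym w∈kernel) _))))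
    ... | false = z≤n

    0ᵛ∈kernel : inKernel 0ᵛ ≡ 1
    0ᵛ∈kernel = 𝟙-T (subst (λ v → T (v ==ᵛ 0ᵛ)) (sym (⟦⟧-0ᵛ α)) (==ᵛ-refl (0ᵛ {k})))

    weighted-bound-0ᵛ : inKernel 0ᵛ * (c * drift f 0ᵛ) < inKernel 0ᵛ * suc b
    weighted-bound-0ᵛ rewrite 0ᵛ∈kernel | drift-0ᵛ f | *-zeroʳ c = s≤s z≤n

    averaged : ∑ n (λ r → inKernel r * (c * error r)) < ∑ n (λ r → inKernel r * suc b)
    averaged = begin-strict
      ∑ n (λ r → inKernel r * (c * error r))    ≡⟨ scaled error ⟩
      c * ∑ n (λ r → inKernel r * error r)      ≡⟨ cong (c *_) decoder-error-average ⟩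
      c * ∑ n (λ w → inKernel w * drift f w)    ≡⟨ scaled (drift f) ⟨
      ∑ n (λ w → inKernel w * (c * drift f w))  <⟨ ∑-mono-< weighted-bound 0ᵛ weighted-bound-0ᵛ ⟩
      ∑ n (λ r → inKernel r * suc b)            ∎

    witness : ∃ λ r → inKernel r * (c * error r) < inKernel r * suc b
    witness = ∑-<-witness _ _ averaged

    r = proj₁ witness
    r-good = proj₂ witness

-- Spans and annihilators

data Span {n} (S : List (𝔽₂^ n)) : ℕ → 𝔽₂^ n → Set where
  0∈span : ∀ {j} → Span S j 0ᵛ
  ⊕∈span : ∀ {j z s} → Span S j z → s ∈ S → Span S (suc j) (z ⊕ s)

Span-mono : ∀ {n} {S : List (𝔽₂^ n)} {i j z} → i ≤ j → Span S i z → Span S j z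
Span-mono _ 0∈span = 0∈span
Span-mono (s≤s i≤j) (⊕∈span z∈S s∈S) = ⊕∈span (Span-mono i≤j z∈S) s∈S

Span-⊕-• : ∀ {n} {S : List (𝔽₂^ n)} {j z p} → Span S j z → p ∈ S → ∀ c →
  Span S (suc j) (z ⊕ (c • p))
Span-⊕-• z∈S p∈S true = ⊕∈span z∈S p∈S
Span-⊕-• {j = j} {z} z∈S p∈S false =
  subst (Span _ (suc j)) (sym (⊕-identityʳ z)) (Span-mono (n≤1+n j) z∈S)

Span-bound : ∀ {n} {S : List (𝔽₂^ n)} (E : 𝔽₂^ n → ℕ) {b} → E 0ᵛ ≡ 0 →
  (∀ z w → E (z ⊕ w) ≤ E z + E w) → (∀ {s} → s ∈ S → E s ≤ b) →
  ∀ {j z} → Span S j z → E z ≤ j * b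
Span-bound E E0ᵛ≡0 subadditive bounded 0∈span = ≤-trans (≤-reflexive E0ᵛ≡0) z≤n
Span-bound E {b} E0ᵛ≡0 subadditive bounded {suc j} (⊕∈span {z = z} {s} z∈S s∈S) = begin
  E (z ⊕ s)  ≤⟨ subadditive z s ⟩
  E z + E s  ≤⟨ +-mono-≤ (Span-bound E E0ᵛ≡0 subadditive bounded z∈S) (bounded s∈S) ⟩
  j * b + b  ≡⟨ +-comm (j * b) b ⟩
  suc j * b  ∎

Span-map : ∀ {m n} {S : List (𝔽₂^ m)} (π : 𝔽₂^ m → 𝔽₂^ n) → (∀ x y → π (x ⊕ y) ≡ π x ⊕ π y) →
  ∀ {j w} → Span (mapL π S) j w → ∃ λ z → Span S j z × π z ≡ w
Span-map π additive 0∈span = 0ᵛ , 0∈span , π0ᵛ≡0ᵛ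
  where
  π0ᵛ≡0ᵛ : π 0ᵛ ≡ 0ᵛ
  π0ᵛ≡0ᵛ = trans (cong π (sym (⊕-self 0ᵛ))) (trans (additive 0ᵛ 0ᵛ) (⊕-self (π 0ᵛ)))
Span-map π additive (⊕∈span w∈πS πs∈πS) with Span-map π additive w∈πS | ∈-map⁻ π πs∈πS
... | z , z∈S , πz≡w | s , s∈S , refl =
  z ⊕ s , ⊕∈span z∈S s∈S , trans (additive z s) (cong (_⊕ π s) πz≡w)

fibre : ∀ {n k} → Vec (𝔽₂^ n) k → 𝔽₂^ k → ℕ
fibre {n} α a = ∑ n λ x → 𝟙 (⟦ α ⟧ x ==ᵛ a)

record IsAnnihilator {n k} (S : List (𝔽₂^ n)) (α : Vec (𝔽₂^ n) k) : Set where
  field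
    annihilates : ∀ {s} → s ∈ S → ⟦ α ⟧ s ≡ 0ᵛ
    kernel⊆span : ∀ {z} → ⟦ α ⟧ z ≡ 0ᵛ → Span S n z
    -- the linear independence of the k rows, in counting form
    fibre-bound : ∀ a → 2 ^ k * fibre α a ≤ 2 ^ n

module _ {n k} {S : List (𝔽₂^ (suc n))} (heads : All (λ s → head s ≡ false) S)
         {α : Vec (𝔽₂^ n) k} (ann : IsAnnihilator (mapL tail S) α) where
  open IsAnnihilator ann

  e₀∷α : Vec (𝔽₂^ (suc n)) (suc k)
  e₀∷α = (true ∷ 0ᵛ) ∷ map (false ∷_) α

  ⟦e₀∷α⟧ : ∀ b x → ⟦ e₀∷α ⟧ (b ∷ x) ≡ b ∷ ⟦ α ⟧ x
  ⟦e₀∷α⟧ b x = cong₂ _∷_ (trans (cong (b xor_) (·-zeroˡ x)) (xor-identityʳ b))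
                         (⟦map⟧ (false ∷_) tail (λ { _ (_ ∷ _) → refl }) α (b ∷ x))

  fibre-e₀∷α : ∀ a₀ a → fibre e₀∷α (a₀ ∷ a) ≡ fibre α a
  fibre-e₀∷α a₀ a = trans (cong₂ _+_ (∑-cong (image false)) (∑-cong (image true))) (halves a₀)
    where
    image : ∀ b x → 𝟙 (⟦ e₀∷α ⟧ (b ∷ x) ==ᵛ a₀ ∷ a) ≡ 𝟙 ((b == a₀) ∧ (⟦ α ⟧ x ==ᵛ a))
    image b x = cong (λ v → 𝟙 (v ==ᵛ a₀ ∷ a)) (⟦e₀∷α⟧ b x)

    halves : ∀ a₀ → ∑ n (λ x → 𝟙 ((false == a₀) ∧ (⟦ α ⟧ x ==ᵛ a)))
                  + ∑ n (λ x → 𝟙 ((true == a₀) ∧ (⟦ α ⟧ x ==ᵛ a))) ≡ fibre α a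
    halves false = trans (cong (λ v → fibre α a + v) (∑-zero n)) (+-identityʳ _)
    halves true = cong (_+ fibre α a) (∑-zero n)

  lift-span : ∀ {j z} → Span (mapL tail S) j z → Span S j (false ∷ z)
  lift-span 0∈span = 0∈span
  lift-span (⊕∈span z∈tailS s∈tailS) with ∈-map⁻ tail s∈tailS
  ... | _ ∷ s , s∈S , refl with All.lookup heads s∈S
  ... | refl = ⊕∈span (lift-span z∈tailS) s∈S

  annihilator-heads-vanish : IsAnnihilator S e₀∷α
  annihilator-heads-vanish = record
    { annihilates = annihilates′
    ; kernel⊆span = kernel⊆span′
    ; fibre-bound = fibre-bound′
    }
    where
    annihilates′ : ∀ {s} → s ∈ S → ⟦ e₀∷α ⟧ s ≡ 0ᵛ
    annihilates′ {_ ∷ s} s∈S with All.lookup heads s∈S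
    ... | refl = trans (⟦e₀∷α⟧ false s) (cong (false ∷_) (annihilates (∈-map⁺ tail s∈S)))

    kernel⊆span′ : ∀ {z} → ⟦ e₀∷α ⟧ z ≡ 0ᵛ → Span S (suc n) z
    kernel⊆span′ {b ∷ z} Az≡0ᵛ with ∷-injective (trans (sym (⟦e₀∷α⟧ b z)) Az≡0ᵛ)
    ... | refl , αz≡0ᵛ = Span-mono (n≤1+n n) (lift-span (kernel⊆span αz≡0ᵛ))

    fibre-bound′ : ∀ a → 2 ^ suc k * fibre e₀∷α a ≤ 2 ^ suc n
    fibre-bound′ (a₀ ∷ a) = begin
      2 ^ suc k * fibre e₀∷α (a₀ ∷ a)  ≡⟨ cong (2 ^ suc k *_) (fibre-e₀∷α a₀ a) ⟩
      2 * 2 ^ k * fibre α a            ≡⟨ *-assoc 2 (2 ^ k) _ ⟩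
      2 * (2 ^ k * fibre α a)          ≤⟨ *-monoʳ-≤ 2 (fibre-bound a) ⟩
      2 ^ suc n                        ∎

-- Gaussian elimination of the first coordinate against the pivot true ∷ u.
eliminate : ∀ {n} → 𝔽₂^ n → 𝔽₂^ (suc n) → 𝔽₂^ n
eliminate u (b ∷ x) = x ⊕ (b • u)

eliminate-additive : ∀ {n} (u : 𝔽₂^ n) x y → eliminate u (x ⊕ y) ≡ eliminate u x ⊕ eliminate u y
eliminate-additive u (b ∷ x) (c ∷ y) =
  trans (cong ((x ⊕ y) ⊕_) (•-distribʳ-xor b c u)) (⊕-interchange x y (b • u) (c • u))

eliminate-kernel : ∀ {n} (u : 𝔽₂^ n) {z} → eliminate u z ≡ 0ᵛ → z ≡ head z • (true ∷ u)
eliminate-kernel u {b ∷ x} x⊕b•u≡0ᵛ = trans (cong (b ∷_) (⊕≡0ᵛ⇒≡ x⊕b•u≡0ᵛ)) (b∷b•u b)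
  where
  b∷b•u : ∀ b → b ∷ (b • u) ≡ b • (true ∷ u)
  b∷b•u true = refl
  b∷b•u false = refl

module _ {n k} {S : List (𝔽₂^ (suc n))} {u : 𝔽₂^ n} (pivot∈S : (true ∷ u) ∈ S)
         {α : Vec (𝔽₂^ n) k} (ann : IsAnnihilator (mapL (eliminate u) S) α) where
  open IsAnnihilator ann

  α∘eliminate : Vec (𝔽₂^ (suc n)) k
  α∘eliminate = map (λ a → (a · u) ∷ a) α

  ⟦α∘eliminate⟧ : ∀ z → ⟦ α∘eliminate ⟧ z ≡ ⟦ α ⟧ (eliminate u z)
  ⟦α∘eliminate⟧ = ⟦map⟧ (λ a → (a · u) ∷ a) (eliminate u) transpose α
    where
    transpose : ∀ a z → ((a · u) ∷ a) · z ≡ a · eliminate u z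
    transpose a (b ∷ x) = trans (xor-comm ((a · u) ∧ b) (a · x))
      (sym (trans (·-distribˡ-⊕ a x (b • u)) (cong ((a · x) xor_) (·-• a u b))))

  fibre-α∘eliminate : ∀ a → fibre α∘eliminate a ≡ fibre α a + fibre α a
  fibre-α∘eliminate a = cong₂ _+_
    (∑-cong λ x → cong (λ v → 𝟙 (v ==ᵛ a))
      (trans (⟦α∘eliminate⟧ (false ∷ x)) (cong ⟦ α ⟧ (⊕-identityʳ x))))
    (trans (∑-cong λ x → cong (λ v → 𝟙 (v ==ᵛ a)) (⟦α∘eliminate⟧ (true ∷ x)))
           (∑-translate (λ x → 𝟙 (⟦ α ⟧ x ==ᵛ a)) u))

  span-preimage : ∀ {j z} → Span (mapL (eliminate u) S) j (eliminate u z) → Span S (suc j) z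
  span-preimage {j} {z} πz∈πS = subst (Span S (suc j)) z′⊕c•pivot≡z (Span-⊕-• z′∈S pivot∈S c)
    where
    lifted = Span-map (eliminate u) (eliminate-additive u) πz∈πS
    z′ = proj₁ lifted
    z′∈S = proj₁ (proj₂ lifted)
    c = head (z ⊕ z′)

    z⊕z′∈kernel : eliminate u (z ⊕ z′) ≡ 0ᵛ
    z⊕z′∈kernel = trans (eliminate-additive u z z′)
      (trans (cong (eliminate u z ⊕_) (proj₂ (proj₂ lifted))) (⊕-self (eliminate u z)))

    z′⊕c•pivot≡z : z′ ⊕ (c • (true ∷ u)) ≡ z
    z′⊕c•pivot≡z = trans (cong (z′ ⊕_) (sym (eliminate-kernel u z⊕z′∈kernel)))
      (trans (⊕-comm z′ (z ⊕ z′)) (⊕-cancelʳ z z′))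

  annihilator-pivot : IsAnnihilator S α∘eliminate
  annihilator-pivot = record
    { annihilates = λ s∈S → trans (⟦α∘eliminate⟧ _) (annihilates (∈-map⁺ (eliminate u) s∈S))
    ; kernel⊆span = λ {z} Az≡0ᵛ →
        span-preimage (kernel⊆span (trans (sym (⟦α∘eliminate⟧ z)) Az≡0ᵛ))
    ; fibre-bound = fibre-bound′
    }
    where
    fibre-bound′ : ∀ a → 2 ^ k * fibre α∘eliminate a ≤ 2 ^ suc n
    fibre-bound′ a = begin
      2 ^ k * fibre α∘eliminate a      ≡⟨ cong (2 ^ k *_) (fibre-α∘eliminate a) ⟩
      2 ^ k * (fibre α a + fibre α a)  ≡⟨ doubling (2 ^ k) (fibre α a) ⟩
      2 * (2 ^ k * fibre α a)          ≤⟨ *-monoʳ-≤ 2 (fibre-bound a) ⟩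
      2 ^ suc n                        ∎
      where
      doubling : ∀ m f → m * (f + f) ≡ 2 * (m * f)
      doubling = solve-∀

pivot? : ∀ {n} (S : List (𝔽₂^ (suc n))) →
  (∃ λ u → (true ∷ u) ∈ S) ⊎ All (λ s → head s ≡ false) S
pivot? [] = inj₂ []
pivot? ((true ∷ u) ∷ S) = inj₁ (u , here refl)
pivot? ((false ∷ _) ∷ S) with pivot? S
... | inj₁ (u , u∈S) = inj₁ (u , there u∈S)
... | inj₂ heads = inj₂ (refl ∷ heads)

annihilator : ∀ n (S : List (𝔽₂^ n)) → Σ ℕ λ k → Σ (Vec (𝔽₂^ n) k) (IsAnnihilator S)
annihilator zero S = 0 , [] , record
  { annihilates = λ _ → refl
  ; kernel⊆span = λ { {[]} _ → 0∈span }
  ; fibre-bound = λ { [] → ≤-refl }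
  }
annihilator (suc n) S with pivot? S
... | inj₁ (u , pivot∈S) =
  let _ , _ , ann = annihilator n (mapL (eliminate u) S) in _ , _ , annihilator-pivot pivot∈S ann
... | inj₂ heads =
  let _ , _ , ann = annihilator n (mapL tail S) in _ , _ , annihilator-heads-vanish heads ann

toℚᵘ-/ : ∀ i d .{{_ : NonZero d}} → toℚᵘ (i / d) ≃ᵘ mkℚᵘ i (pred d)
toℚᵘ-/ i (suc d) = toℚᵘ-fromℚᵘ (mkℚᵘ i d)

toℚᵘ-1-1/ : ∀ m .{{_ : NonZero m}} →
  toℚᵘ (1ℚ ℚ.- (+ 1) / m) ≃ᵘ ℚᵘ.1ℚᵘ ℚᵘ.- mkℚᵘ (+ 1) (pred m)
toℚᵘ-1-1/ m = ℚᵘ.≃-trans (toℚᵘ-homo-+ 1ℚ (ℚ.- ((+ 1) / m))) (ℚᵘ.+-congʳ ℚᵘ.1ℚᵘ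
  (ℚᵘ.≃-trans (toℚᵘ-homo‿- ((+ 1) / m)) (ℚᵘ.-‿cong (toℚᵘ-/ (+ 1) m))))

1/m*1/n : ∀ m n .{{_ : NonZero m}} .{{_ : NonZero n}} →
  (+ 1 / m) ℚ.* (+ 1 / n) ≡ _/_ (+ 1) (m * n) {{m*n≢0 m n}}
1/m*1/n m@(suc _) n@(suc _) = toℚᵘ-injective (ℚᵘ.≃-trans (toℚᵘ-homo-* (+ 1 / m) (+ 1 / n))
  (ℚᵘ.≃-trans (ℚᵘ.*-cong (toℚᵘ-/ (+ 1) m) (toℚᵘ-/ (+ 1) n))
              (ℚᵘ.≃-sym (toℚᵘ-/ (+ 1) (m * n) {{m*n≢0 m n}}))))

1-1/m≤p/d⇔ : ∀ m p d .{{_ : NonZero m}} .{{_ : NonZero d}} →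
  (1ℚ ℚ.- (+ 1) / m ℚ.≤ (+ p) / d) ⇔ (m * d ≤ p * m + d)
1-1/m≤p/d⇔ m@(suc m-1) p d@(suc d-1) = mk⇔
  (λ le → from-ℤ (unwrap (toℚᵘ-mono-≤ le)))
  (λ le → toℚᵘ-cancel-≤ (wrap (to-ℤ le)))
  where
  L = ℚᵘ.1ℚᵘ ℚᵘ.- mkℚᵘ (+ 1) m-1
  R = mkℚᵘ (+ p) d-1

  unwrap : toℚᵘ (1ℚ ℚ.- (+ 1) / m) ≤ᵘ toℚᵘ ((+ p) / d) → L ≤ᵘ R
  unwrap = ℚᵘ.≤-respʳ-≃ (toℚᵘ-/ (+ p) d) ∘ ℚᵘ.≤-respˡ-≃ (toℚᵘ-1-1/ m)

  wrap : L ≤ᵘ R → toℚᵘ (1ℚ ℚ.- (+ 1) / m) ≤ᵘ toℚᵘ ((+ p) / d)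
  wrap = ℚᵘ.≤-respʳ-≃ (ℚᵘ.≃-sym (toℚᵘ-/ (+ p) d)) ∘ ℚᵘ.≤-respˡ-≃ (ℚᵘ.≃-sym (toℚᵘ-1-1/ m))

  M D P : ℤ
  M = + m
  D = + d
  P = + p

  ↧L≡M : + (1 * m) ≡ M
  ↧L≡M = cong +_ (*-identityˡ m)

  lhs : + (m * d) ≡ M ℤ.* D
  lhs = ℤ.pos-* m d

  rhs : + (p * m + d) ≡ P ℤ.* M ℤ.+ D
  rhs = trans (ℤ.pos-+ (p * m) d) (cong (ℤ._+ D) (ℤ.pos-* p m))

  -- The numerator of L is 1·M − 1·1, i.e. m − 1.
  add-D : ∀ M D → (+ 1 ℤ.* M ℤ.+ ℤ.- (+ 1) ℤ.* + 1) ℤ.* D ℤ.+ D ≡ M ℤ.* D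
  add-D = ℤ-solve-∀

  sub-D : ∀ M D → M ℤ.* D ℤ.- D ≡ (+ 1 ℤ.* M ℤ.+ ℤ.- (+ 1) ℤ.* + 1) ℤ.* D
  sub-D = ℤ-solve-∀

  cancel-D : ∀ X D → X ℤ.+ D ℤ.- D ≡ X
  cancel-D = ℤ-solve-∀

  from-ℤ : L ≤ᵘ R → m * d ≤ p * m + d
  from-ℤ (*≤* le) = ℤ.drop‿+≤+ (subst₂ ℤ._≤_ (trans (add-D M D) (sym lhs))
    (trans (cong (λ v → P ℤ.* v ℤ.+ D) ↧L≡M) (sym rhs)) (ℤ.+-monoˡ-≤ D le))

  to-ℤ : m * d ≤ p * m + d → L ≤ᵘ R
  to-ℤ le = *≤* (subst₂ ℤ._≤_ (sub-D M D)
    (trans (cancel-D (P ℤ.* M) D) (cong (P ℤ.*_) (sym ↧L≡M)))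
    (ℤ.+-monoˡ-≤ (ℤ.- D) (subst₂ ℤ._≤_ lhs rhs (ℤ.+≤+ le))))

-- One-way protocols for XOR-functions

module Protocol {n} .{{_ : NonZero n}} (f : 𝔽₂^ n → Bool)
                {t} (M : 𝔽₂^ n → 𝔽₂^ t) (h : 𝔽₂^ t → 𝔽₂^ n → Bool) where

  N : ℕ
  N = 2 ^ n

  private instance
    N≢0 : NonZero N
    N≢0 = m^n≢0 2 n

  rowError : 𝔽₂^ n → ℕ
  rowError x = dist (h (M x)) (λ y → f (x ⊕ y))

  totalError : ℕ
  totalError = ∑ n rowError

  goodRow : 𝔽₂^ n → Bool
  goodRow x = ⌊ 6 * n * rowError x ≤? N ⌋

  goodRows badRows : ℕ
  goodRows = ∑ n (𝟙 ∘ goodRow)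
  badRows = ∑ n (𝟙 ∘ not ∘ goodRow)

  nearPeriods : List (𝔽₂^ n)
  nearPeriods = filter (λ z → 3 * n * drift f z ≤? N) (allVecs n)

  error-bound : 1ℚ ℚ.- (+ 1 / 24) ℚ.* ((+ 1) / n) ℚ.≤ PrU² n (λ x y → h (M x) y == xorFn f x y) →
    24 * n * totalError ≤ N * N
  error-bound accurate = +-cancelˡ-≤ (24 * n * correct) _ _ (begin
    24 * n * correct + 24 * n * totalError  ≡⟨ *-distribˡ-+ (24 * n) correct totalError ⟨
    24 * n * (correct + totalError)        ≡⟨ cong (24 * n *_) correct+error ⟩
    24 * n * 2 ^ (n + n)
      ≤⟨ Equivalence.to (1-1/m≤p/d⇔ (24 * n) correct _) rescaled ⟩
    correct * (24 * n) + 2 ^ (n + n)       ≡⟨ cong₂ _+_ (*-comm correct _) (^-distribˡ-+-* 2 n n) ⟩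
    24 * n * correct + N * N               ∎)
    where
    correct : ℕ
    correct = sum (mapL (λ x → count (λ y → h (M x) y == f (x ⊕ y)) (allVecs n)) (allVecs n))

    correct+error : correct + totalError ≡ 2 ^ (n + n)
    correct+error = begin-equality
      correct + totalError
        ≡⟨ cong (_+ totalError) (∑-allVecs n _) ⟩
      ∑ n (λ x → count (λ y → h (M x) y == f (x ⊕ y)) (allVecs n)) + totalError
        ≡⟨ ∑-+ n _ rowError ⟨
      ∑ n (λ x → count (λ y → h (M x) y == f (x ⊕ y)) (allVecs n) + rowError x)
        ≡⟨ ∑-cong (λ x → agreements+dist (h (M x)) (λ y → f (x ⊕ y))) ⟩
      ∑ n (λ _ → N)
        ≡⟨ ∑-const n N ⟩
      N * N
        ≡⟨ ^-distribˡ-+-* 2 n n ⟨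
      2 ^ (n + n)
        ∎

    instance
      24n≢0 : NonZero (24 * n)
      24n≢0 = m*n≢0 24 n
      N²≢0 : NonZero (2 ^ (n + n))
      N²≢0 = m^n≢0 2 (n + n)

    rescaled : 1ℚ ℚ.- (+ 1) / (24 * n) ℚ.≤ (+ correct) / 2 ^ (n + n)
    rescaled = subst (λ c → 1ℚ ℚ.- c ℚ.≤ (+ correct) / 2 ^ (n + n)) (1/m*1/n 24 n) accurate

  markov : N * badRows ≤ 6 * n * totalError
  markov = begin
    N * badRows                          ≡⟨ ∑-*ˡ n N _ ⟨
    ∑ n (λ x → N * 𝟙 (not (goodRow x)))  ≤⟨ ∑-mono bad-row ⟩
    ∑ n (λ x → 6 * n * rowError x)       ≡⟨ ∑-*ˡ n (6 * n) rowError ⟩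
    6 * n * totalError                   ∎
    where
    bad-row : ∀ x → N * 𝟙 (not ⌊ 6 * n * rowError x ≤? N ⌋) ≤ 6 * n * rowError x
    bad-row x with 6 * n * rowError x ≤? N
    ... | yes _ = ≤-trans (≤-reflexive (*-zeroʳ N)) z≤n
    ... | no ≰ = ≤-trans (≤-reflexive (*-identityʳ N)) (<⇒≤ (≰⇒> ≰))

  badRows-bound : 24 * n * totalError ≤ N * N → 4 * badRows ≤ N
  badRows-bound small = *-cancelˡ-≤ N (begin
    N * (4 * badRows)         ≡⟨ x∙yz≈y∙xz N 4 badRows ⟩
    4 * (N * badRows)         ≤⟨ *-monoʳ-≤ 4 markov ⟩
    4 * (6 * n * totalError)  ≡⟨ reassociate n totalError ⟩
    24 * n * totalError       ≤⟨ small ⟩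
    N * N                     ∎)
    where
    reassociate : ∀ n e → 4 * (6 * n * e) ≡ 24 * n * e
    reassociate = solve-∀

  rows-partition : goodRows + badRows ≡ N
  rows-partition = begin-equality
    goodRows + badRows                               ≡⟨ ∑-+ n _ _ ⟨
    ∑ n (λ x → 𝟙 (goodRow x) + 𝟙 (not (goodRow x)))  ≡⟨ ∑-cong (𝟙+𝟙-not ∘ goodRow) ⟩
    ∑ n (λ _ → 1)                                    ≡⟨ ∑-const n 1 ⟩
    N * 1                                            ≡⟨ *-identityʳ N ⟩
    N                                                ∎

  drift-≤-rowErrors : ∀ x x′ → M x ≡ M x′ → drift f (x ⊕ x′) ≤ rowError x + rowError x′
  drift-≤-rowErrors x x′ same-message = begin
    drift f (x ⊕ x′)
      ≡⟨ dist-translate (λ y → f (y ⊕ (x ⊕ x′))) f x′ ⟨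
    dist (λ y → f ((y ⊕ x′) ⊕ (x ⊕ x′))) (λ y → f (y ⊕ x′))
      ≡⟨ ∑-cong (λ y → cong₂ (λ u v → 𝟙 (f u xor f v)) (shift y) (⊕-comm y x′)) ⟩
    dist (λ y → f (x ⊕ y)) (λ y → f (x′ ⊕ y))
      ≤⟨ dist-triangle (λ y → f (x ⊕ y)) (h (M x)) (λ y → f (x′ ⊕ y)) ⟩
    dist (λ y → f (x ⊕ y)) (h (M x)) + dist (h (M x)) (λ y → f (x′ ⊕ y))
      ≡⟨ cong₂ _+_ (dist-comm (λ y → f (x ⊕ y)) (h (M x)))
                   (cong (λ m → dist (h m) (λ y → f (x′ ⊕ y))) same-message) ⟩
    rowError x + rowError x′
      ∎
    where
    shift : ∀ y → (y ⊕ x′) ⊕ (x ⊕ x′) ≡ x ⊕ y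
    shift y = trans (⊕-interchange y x′ x x′)
      (trans (cong ((y ⊕ x) ⊕_) (⊕-self x′)) (trans (⊕-identityʳ (y ⊕ x)) (⊕-comm y x)))

  same-message⇒nearPeriod : ∀ {x x′} → T (goodRow x) → T (goodRow x′) → M x ≡ M x′ →
    x ⊕ x′ ∈ nearPeriods
  same-message⇒nearPeriod {x} {x′} good good′ same-message =
    ∈-filter⁺ (λ z → 3 * n * drift f z ≤? N) (allVecs-complete (x ⊕ x′)) (*-cancelˡ-≤ 2 (begin
      2 * (3 * n * drift f (x ⊕ x′))
        ≡⟨ reassociate n (drift f (x ⊕ x′)) ⟩
      6 * n * drift f (x ⊕ x′)
        ≤⟨ *-monoʳ-≤ (6 * n) (drift-≤-rowErrors x x′ same-message) ⟩
      6 * n * (rowError x + rowError x′)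
        ≡⟨ *-distribˡ-+ (6 * n) (rowError x) (rowError x′) ⟩
      6 * n * rowError x + 6 * n * rowError x′
        ≤⟨ +-mono-≤ (toWitness good) (toWitness good′) ⟩
      N + N
        ≡⟨ cong (λ v → N + v) (+-identityʳ N) ⟨
      2 * N
        ∎))
    where
    reassociate : ∀ n d → 2 * (3 * n * d) ≡ 6 * n * d
    reassociate = solve-∀

  module _ {k} {α : Vec (𝔽₂^ n) k} (ann : IsAnnihilator nearPeriods α) where
    open IsAnnihilator ann

    same-message⇒same-image : ∀ {x x′} → T (goodRow x) → T (goodRow x′) → M x ≡ M x′ →
      ⟦ α ⟧ x ≡ ⟦ α ⟧ x′
    same-message⇒same-image {x} {x′} good good′ same-message = ⊕≡0ᵛ⇒≡
      (trans (sym (⟦⟧-⊕ α x x′)) (annihilates (same-message⇒nearPeriod good good′ same-message)))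

    messageClass : 𝔽₂^ t → ℕ
    messageClass m = ∑ n λ x → 𝟙 (M x ==ᵛ m) * 𝟙 (goodRow x)

    messageClass-bound : ∀ m → 2 ^ k * messageClass m ≤ N
    messageClass-bound m with 0 <? messageClass m
    ... | no empty = begin
      2 ^ k * messageClass m  ≡⟨ cong (2 ^ k *_) (n≤0⇒n≡0 (≮⇒≥ empty)) ⟩
      2 ^ k * 0               ≡⟨ *-zeroʳ (2 ^ k) ⟩
      0                       ≤⟨ z≤n ⟩
      N                       ∎
    ... | yes inhabited = ≤-trans (*-monoʳ-≤ (2 ^ k) (∑-mono in-fibre)) (fibre-bound (⟦ α ⟧ x₀))
      where
      member : ∃ λ x → 0 < 𝟙 (M x ==ᵛ m) * 𝟙 (goodRow x)
      member = ∑-positive _ inhabited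

      x₀ = proj₁ member
      x₀-good = 𝟙*𝟙-positive {M x₀ ==ᵛ m} (proj₂ member)

      in-fibre : ∀ x → 𝟙 (M x ==ᵛ m) * 𝟙 (goodRow x) ≤ 𝟙 (⟦ α ⟧ x ==ᵛ ⟦ α ⟧ x₀)
      in-fibre x = 𝟙*𝟙≤𝟙 λ Mx==m good → subst (λ v → T (v ==ᵛ ⟦ α ⟧ x₀))
        (sym (same-message⇒same-image good (proj₂ x₀-good)
          (trans (==ᵛ⇒≡ Mx==m) (sym (==ᵛ⇒≡ (proj₁ x₀-good))))))
        (==ᵛ-refl (⟦ α ⟧ x₀))

    goodRows-bound : 2 ^ k * goodRows ≤ 2 ^ t * N
    goodRows-bound = begin
      2 ^ k * goodRows
        ≡⟨ cong (2 ^ k *_) (∑-cong λ x → ∑-delta (M x) (λ _ → 𝟙 (goodRow x))) ⟨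
      2 ^ k * ∑ n (λ x → ∑ t (λ m → 𝟙 (M x ==ᵛ m) * 𝟙 (goodRow x)))
        ≡⟨ cong (2 ^ k *_) (∑-comm n t _) ⟩
      2 ^ k * ∑ t messageClass
        ≡⟨ ∑-*ˡ t (2 ^ k) messageClass ⟨
      ∑ t (λ m → 2 ^ k * messageClass m)
        ≤⟨ ∑-mono messageClass-bound ⟩
      ∑ t (λ _ → N)
        ≡⟨ ∑-const t N ⟩
      2 ^ t * N
        ∎

    rank≤message-length : 24 * n * totalError ≤ N * N → k ≤ t
    rank≤message-length small = ≮⇒≥ λ t<k → <⇒≱ (n<1+n 3) (*-cancelʳ-≤ 4 3 N (4N≤3N t<k))
      where
      goodRows-half : t < k → 2 * goodRows ≤ N
      goodRows-half t<k = *-cancelˡ-≤ (2 ^ t) {{m^n≢0 2 t}} (begin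
        2 ^ t * (2 * goodRows)  ≡⟨ reassociate (2 ^ t) goodRows ⟩
        2 ^ suc t * goodRows    ≤⟨ *-monoˡ-≤ goodRows (^-monoʳ-≤ 2 t<k) ⟩
        2 ^ k * goodRows        ≤⟨ goodRows-bound ⟩
        2 ^ t * N               ∎)
        where
        reassociate : ∀ a g → a * (2 * g) ≡ 2 * a * g
        reassociate = solve-∀

      4N≤3N : t < k → 4 * N ≤ 3 * N
      4N≤3N t<k = begin
        4 * N                             ≡⟨ cong (4 *_) rows-partition ⟨
        4 * (goodRows + badRows)          ≡⟨ *-distribˡ-+ 4 goodRows badRows ⟩
        4 * goodRows + 4 * badRows        ≡⟨ cong (_+ 4 * badRows) (*-assoc 2 2 goodRows) ⟩
        2 * (2 * goodRows) + 4 * badRows  ≤⟨ +-mono-≤ (*-monoʳ-≤ 2 (goodRows-half t<k))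
                                                      (badRows-bound small) ⟩
        2 * N + N                         ≡⟨ +-comm (2 * N) N ⟩
        3 * N                             ∎

    kernel-drift : ∀ w → ⟦ α ⟧ w ≡ 0ᵛ → 3 * drift f w ≤ N
    kernel-drift w w∈kernel = *-cancelˡ-≤ n (begin
      n * (3 * drift f w)  ≡⟨ x∙yz≈y∙xz n 3 (drift f w) ⟩
      3 * (n * drift f w)  ≡⟨ *-assoc 3 n (drift f w) ⟨
      3 * n * drift f w    ≤⟨ Span-bound E E0ᵛ≡0 E-subadditive near (kernel⊆span w∈kernel) ⟩
      n * N                ∎)
      where
      E : 𝔽₂^ n → ℕ
      E z = 3 * n * drift f z

      E0ᵛ≡0 : E 0ᵛ ≡ 0
      E0ᵛ≡0 = trans (cong (3 * n *_) (drift-0ᵛ f)) (*-zeroʳ (3 * n))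

      E-subadditive : ∀ z w → E (z ⊕ w) ≤ E z + E w
      E-subadditive z w = ≤-trans (*-monoʳ-≤ (3 * n) (drift-subadditive f z w))
                                  (≤-reflexive (*-distribˡ-+ (3 * n) _ _))

      near : ∀ {s} → s ∈ nearPeriods → E s ≤ N
      near = proj₂ ∘ ∈-filter⁻ (λ z → 3 * n * drift f z ≤? N) {xs = allVecs n}

    linear-approximation :
      Σ (𝔽₂^ k → Bool) λ g → 1ℚ ℚ.- (+ 1) / 3 ℚ.≤ PrU n (λ x → g (⟦ α ⟧ x) == f x)
    linear-approximation = g , Equivalence.from (1-1/m≤p/d⇔ 3 agreements N) (begin
      3 * N                        ≡⟨ cong (3 *_) (agreements+dist (g ∘ ⟦ α ⟧) f) ⟨
      3 * (agreements + errors)    ≡⟨ *-distribˡ-+ 3 agreements errors ⟩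
      3 * agreements + 3 * errors  ≤⟨ +-mono-≤ (≤-reflexive (*-comm 3 agreements)) 3·errors≤N ⟩
      agreements * 3 + N           ∎)
      where
      decoding = kernel-decoding f α 3 N kernel-drift
      g = proj₁ decoding
      3·errors≤N = proj₂ decoding
      agreements = count (λ x → g (⟦ α ⟧ x) == f x) (allVecs n)
      errors = dist (g ∘ ⟦ α ⟧) f

theorem1p4 : Σ ℚ λ c → (0ℚ ℚ.< c) ×
    ((n : ℕ) .{{_ : NonZero n}} (f : 𝔽₂^ n → Bool) (t : ℕ) →
      OneWayProtocol n (c ℚ.* ((+ 1) / n)) (xorFn f) t →
      Σ ℕ λ k → (k ≤ t) × LinearApprox n ((+ 1) / 3) f k)
theorem1p4 = + 1 / 24 , positive⁻¹ _ , λ n f t (M , h , accurate) →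
  let open Protocol f M h
      k , α , ann = annihilator n nearPeriods
  in k , rank≤message-length ann (error-bound accurate) , α , linear-approximation ann
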